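{- Let $\Sigma$ be a finite binary relational signature with $k=|\Sigma|$, and let $(Y,Z_{R_1},\dots,Z_{R_k},\tau)$ be a ranked twin-model of width $d$ of a $\Sigma$-structure $\mathbf A$. Then the Gaifman graph of $(Y,Z_{R_1},\dots,Z_{R_k})$, i.e. the graph on $V(Y)$ in which distinct $u,v$ are adjacent iff $uv$ is an edge of $Y$ or $(u,v)$ or $(v,u)$ belongs to some $Z_{R_i}$, is $(d+k+1)$-degenerate.
   Context: A graph is $m$-degenerate if each of its induced subgraphs has a vertex of degree at most $m$. Structures are finite and irreflexive. Twin-models. For a rooted tree $Y$: $I(Y)$ internal nodes, $L(Y)$ leaves, $r(Y)$ root, $u\preceq_Y v$ iff $u$ lies on the root-to-$v$ path, $\pi_Y(v)$ the parent of a non-root $v$. For $\Sigma=\{R_1,\dots,R_k\}$, a twin-model is $(Y,Z_{R_1},\dots,Z_{R_k})$ with $Y$ a rooted binary tree (every internal node has exactly two children) and $Z_{R_i}\subseteq V(Y)^2$ such that (minimality) if $(u,v)\in Z_{R_i}$ there is no $(u',v')\neq(u,v)$ in $Z_{R_i}$ with $u'\preceq_Y u$, $v'\preceq_Y v$; and (consistency) every cycle in the graph $Y\cup\bigcup_i Z_{R_i}$ admitting a traversal that traverses all its $Y$-edges away from the root contains two consecutive edges from $\bigcup_i Z_{R_i}$. It is a twin-model of $\mathbf A$ if $A=L(Y)$ and $R_i(\mathbf A)=\{(u,v):\exists u'\preceq_Y u,\exists v'\preceq_Y v,\ (u',v')\in Z_{R_i}\}$. With $n=|A|$, a ranking is $\tau:V(Y)\to[n]$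 that is a bijection $I(Y)\to[n-1]$, equals $n$ on $L(Y)$, satisfies $u\prec_Y v\Rightarrow\tau(u)<\tau(v)$, and $(u,v)\in Z_{R_i}\Rightarrow\max(\tau(\pi_Y(u)),\tau(\pi_Y(v)))<\min(\tau(u),\tau(v))$. For $1<t\le n$ the boundary is $\partial_tY=\{u:\tau(u)\ge t,\ \tau(\pi_Y(u))<t\}$, and the layer $\mathbf L_t$ is the structure on $\partial_tY$ with relations $R_i(\mathbf L_t)=\{(u,v):\exists u'\preceq_Y u,\exists v'\preceq_Y v,(u',v')\in Z_{R_i}\}$ and $R_i^*(\mathbf L_t)=\{(u,v):\exists u'\succeq_Y u,\exists v'\succeq_Y v,(u',v')\ne(u,v),\ \{(u',v'),(v',u')\}\cap Z_{R_i}\ne\emptyset\}$; $\partial_1Y=\{r(Y)\}$ with $\mathbf L_1$ the one-element structure. The width of the ranked twin-model is $\max_{t\in[n]}\max_{v\in\partial_tY}\sum_i|\{w:(v,w)\in R_i^*(\mathbf L_t)\}|$. -}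

module Defs where

open import Data.Nat using (ℕ; zero; suc; _+_; _∸_; _≤_; _<_; _⊔_; _⊓_; _≤ᵇ_; _<ᵇ_)
open import Data.Bool using (Bool; true; false; _∧_; _∨_; not; if_then_else_; T)
open import Data.Maybe using (Maybe; just; nothing; maybe′)
open import Data.List using (List; []; _∷_; _++_; map; length; filterᵇ; upTo; allFin; concatMap; foldr)
open import Data.Fin using (Fin; toℕ; fromℕ<)
open import Data.Product using (Σ; _×_; ∃; ∃-syntax; _,_; proj₁)
open import Relation.Nullary using (¬_; yes; no)
open import Relation.Binary.PropositionalEquality using (_≡_; _≢_)
open import Function using (_∘_; _⇔_)
open import Function.Definitions using (Injective)
import Data.Nat as ℕ

data BTree : Set where
  leaf : BTree
  node : BTree → BTree → BTree

-- V(Y): the vertices of Y, addressed by the path from the root.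
data Pos : BTree → Set where
  here  : ∀ {t} → Pos t
  left  : ∀ {l r} → Pos l → Pos (node l r)
  right : ∀ {l r} → Pos r → Pos (node l r)

allPos : (t : BTree) → List (Pos t)
allPos leaf       = here ∷ []
allPos (node l r) = here ∷ (map left (allPos l) ++ map right (allPos r))

eqPos : ∀ {t} → Pos t → Pos t → Bool
eqPos here      here      = true
eqPos here      (left v)  = false
eqPos here      (right v) = false
eqPos (left u)  here      = false
eqPos (left u)  (left v)  = eqPos u v
eqPos (left u)  (right v) = false
eqPos (right u) here      = false
eqPos (right u) (left v)  = false
eqPos (right u) (right v) = eqPos u v

isAnc : ∀ {t} → Pos t → Pos t → Bool
isAnc here      v         = true
isAnc (left u)  here      = false
isAnc (left u)  (left v)  = isAnc u v
isAnc (left u)  (right v) = false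
isAnc (right u) here      = false
isAnc (right u) (left v)  = false
isAnc (right u) (right v) = isAnc u v

_⪯_ : ∀ {t} → Pos t → Pos t → Set
u ⪯ v = T (isAnc u v)

_≺_ : ∀ {t} → Pos t → Pos t → Set
u ≺ v = u ⪯ v × u ≢ v

parent : ∀ {t} → Pos t → Maybe (Pos t)
parent here      = nothing
parent (left u)  = just (maybe′ left here (parent u))
parent (right u) = just (maybe′ right here (parent u))

isLeaf : ∀ {t} → Pos t → Bool
isLeaf {leaf}     here = true
isLeaf {node _ _} here = false
isLeaf (left u)  = isLeaf u
isLeaf (right u) = isLeaf u

Leaf : BTree → Set
Leaf t = Σ (Pos t) (λ u → T (isLeaf u))

nLeaves : BTree → ℕ
nLeaves leaf       = 1
nLeaves (node l r) = nLeaves l + nLeaves r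

isParentOf : ∀ {t} → Pos t → Pos t → Bool
isParentOf u v = maybe′ (λ p → eqPos p u) false (parent v)

count : ∀ {A : Set} → (A → Bool) → List A → ℕ
count p xs = length (filterᵇ p xs)

anyL : ∀ {A : Set} → (A → Bool) → List A → Bool
anyL p []       = false
anyL p (x ∷ xs) = p x ∨ anyL p xs

anyFin : ∀ k → (Fin k → Bool) → Bool
anyFin k p = anyL p (allFin k)

sumFin : ∀ k → (Fin k → ℕ) → ℕ
sumFin k f = foldr _+_ 0 (map f (allFin k))

maxL : List ℕ → ℕ
maxL = foldr _⊔_ 0

cyc : ∀ {m} → Fin m → Fin m
cyc {suc m} i with suc (toℕ i) ℕ.<? suc m
... | yes p = fromℕ< p
... | no _  = Fin.zero

record Structure (k : ℕ) (Y : BTree) : Set₁ where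
  field
    rel   : Fin k → Leaf Y → Leaf Y → Set
    irrefl : ∀ i a → ¬ rel i a a

module _ {k : ℕ} (Y : BTree) (Z : Fin k → Pos Y → Pos Y → Bool) where

  inZ : Pos Y → Pos Y → Bool
  inZ u v = anyFin k (λ i → Z i u v)

  yEdge : Pos Y → Pos Y → Bool
  yEdge u v = isParentOf u v ∨ isParentOf v u

  zEdge : Pos Y → Pos Y → Bool
  zEdge u v = inZ u v ∨ inZ v u

  Minimal : Set
  Minimal = ∀ i u v → T (Z i u v) →
            ∀ u' v' → u' ⪯ u → v' ⪯ v → T (Z i u' v') → (u' ≡ u × v' ≡ v)

  IsCycle : (m : ℕ) → (Fin m → Pos Y) → Set
  IsCycle m c = 3 ≤ m × Injective _≡_ _≡_ c ×
                (∀ j → T (yEdge (c j) (c (cyc j)) ∨ zEdge (c j) (c (cyc j))))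

  DownTraversal : (m : ℕ) → (Fin m → Pos Y) → Set
  DownTraversal m c = ∀ j → T (yEdge (c j) (c (cyc j))) → T (isParentOf (c j) (c (cyc j)))

  Consistent : Set
  Consistent = ∀ m (c : Fin m → Pos Y) → IsCycle m c → DownTraversal m c →
               ∃[ j ] (T (zEdge (c j) (c (cyc j))) × T (zEdge (c (cyc j)) (c (cyc (cyc j)))))

  IsTwinModel : Set
  IsTwinModel = Minimal × Consistent

  IsTwinModelOf : Structure k Y → Set
  IsTwinModelOf 𝐀 = IsTwinModel ×
    (∀ i (a b : Leaf Y) → Structure.rel 𝐀 i a b ⇔
       (∃[ u' ] ∃[ v' ] (u' ⪯ proj₁ a × v' ⪯ proj₁ b × T (Z i u' v'))))

  -- τ(π_Y(u)), with the convention 0 for the root (which has no parent)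
  parentRank : (Pos Y → ℕ) → Pos Y → ℕ
  parentRank τ u = maybe′ τ 0 (parent u)

  IsRanking : (Pos Y → ℕ) → Set
  IsRanking τ =
    (∀ u → T (not (isLeaf u)) → 1 ≤ τ u × τ u ≤ nLeaves Y ∸ 1) ×
    (∀ u v → T (not (isLeaf u)) → T (not (isLeaf v)) → τ u ≡ τ v → u ≡ v) ×
    (∀ j → 1 ≤ j → j ≤ nLeaves Y ∸ 1 → ∃[ u ] (T (not (isLeaf u)) × τ u ≡ j)) ×
    (∀ u → T (isLeaf u) → τ u ≡ nLeaves Y) ×
    (∀ u v → u ≺ v → τ u < τ v) ×
    (∀ i u v → T (Z i u v) → parentRank τ u ⊔ parentRank τ v < τ u ⊓ τ v)

  boundary : (Pos Y → ℕ) → ℕ → List (Pos Y)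
  boundary τ t = filterᵇ
    (λ u → (t ≤ᵇ τ u) ∧ maybe′ (λ p → τ p <ᵇ t) false (parent u)) (allPos Y)

  rStar : Fin k → Pos Y → Pos Y → Bool
  rStar i u v = anyL (λ u' → anyL (λ v' →
      isAnc u u' ∧ isAnc v v' ∧ not (eqPos u u' ∧ eqPos v v') ∧ (Z i u' v' ∨ Z i v' u'))
      (allPos Y)) (allPos Y)

  starDeg : (Pos Y → ℕ) → ℕ → Pos Y → ℕ
  starDeg τ t v = sumFin k (λ i → count (λ w → rStar i v w) (boundary τ t))

  -- width of the ranked twin-model: max over t ∈ [n], v ∈ ∂_t Y.
  -- t = 1 contributes 0 (𝐋_1 is the one-element structure, whose relations
  -- are empty by irreflexivity); remaining t range over 2..n.
  width : (Pos Y → ℕ) → ℕ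
  width τ = maxL (concatMap (λ t → map (starDeg τ t) (boundary τ t))
                            (map (2 +_) (upTo (nLeaves Y ∸ 1))))

  gaifmanAdj : Pos Y → Pos Y → Bool
  gaifmanAdj u v = not (eqPos u v) ∧ (yEdge u v ∨ zEdge u v)

Degenerate : {V : Set} → ℕ → List V → (V → V → Bool) → Set
Degenerate {V} m vs adj =
  ∀ (S : V → Bool) → (∃[ v ] T (S v)) →
  ∃[ v ] (T (S v) × count (λ w → S w ∧ adj v w) vs ≤ m)

-- Choose in the (nonempty) vertex set S a vertex v for which τ(π v) is largest.
-- No child c of v lies in S, since τ(π c) = τ v > τ(π v). Every Z-neighbour w
-- satisfies τ(π w) ≤ τ(π v) = τ p < τ w, where p = π v; so either π w = p and w
-- is the sibling of v, or τ(π w) < τ p ≤ τ w, i.e. w lies on the boundary ∂_{τ p}Y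
-- together with p, and the Z-edge vw witnesses (p , w) ∈ R_i^*(𝐋_{τ p}). Hence v
-- has at most 1 + 1 + d neighbours in S (only its parent when Σ is empty).
module Submission where

open import Defs
open import Data.Nat using (ℕ; zero; suc; _+_; _∸_; _≤_; _<_; _⊔_; _⊓_; _≤ᵇ_; _<ᵇ_; z≤n; s≤s)
open import Data.Nat.Properties
open import Data.Bool using (Bool; true; false; _∧_; _∨_; not; T)
open import Data.Bool.Properties using (T?; T-∧; T-∨; T-not-≡)
open import Data.Fin using (Fin)
open import Data.List using (List; []; _∷_; _++_; map; length; filterᵇ; foldr; upTo; allFin)
open import Data.List.Properties using (filter-++; filter-none; length-++)
open import Data.List.Extrema.Nat using (argmax; argmax-all; f[xs]≤f[argmax])
open import Data.List.Membership.Propositional using (_∈_)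
open import Data.List.Membership.Propositional.Properties
  using (∈-map⁺; ∈-++⁺ˡ; ∈-++⁺ʳ; ∈-filter⁺; ∈-filter⁻; ∈-upTo⁺; ∈-concatMap⁺; ∈-allFin)
import Data.List.Relation.Unary.All as All
open import Data.List.Relation.Unary.All.Properties using (all-filter)
open import Data.List.Relation.Unary.Any as Any using (here; there)
open import Data.List.Relation.Binary.Sublist.Propositional using (_⊆_; ⊆-refl)
open import Data.List.Relation.Binary.Sublist.Propositional.Properties using (filter⁺; length-mono-≤; to-≋)
open import Data.List.Relation.Binary.Pointwise using (Pointwise-≡⇒≡)
open import Data.Maybe using (just; nothing; maybe′)
open import Data.Product using (_×_; ∃-syntax; _,_; proj₁; proj₂)
open import Data.Sum using (_⊎_; inj₁; inj₂)
open import Data.Unit using (tt)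
open import Function using (_∘_)
open import Function.Bundles using (Equivalence)
open import Relation.Nullary using (¬_; yes; no; contradiction)
open import Relation.Nullary.Decidable using (map′)
open import Relation.Binary.Definitions using (DecidableEquality)
open import Relation.Binary.PropositionalEquality

module _ {A : Set} where

  filterᵇ-⊆ : {f g : A → Bool} → (∀ x → T (f x) → T (g x)) → ∀ xs → filterᵇ f xs ⊆ filterᵇ g xs
  filterᵇ-⊆ {f} {g} f⇒g xs = filter⁺ (T? ∘ f) (T? ∘ g) (λ { refl → f⇒g _ }) (⊆-refl {x = xs})

  count-mono : {f g : A → Bool} → (∀ x → T (f x) → T (g x)) → ∀ xs → count f xs ≤ count g xs
  count-mono f⇒g xs = length-mono-≤ (filterᵇ-⊆ f⇒g xs)

  -- Equal counts would force the two filtered lists, one a sublist of the other, to coincide.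
  count-< : {f g : A → Bool} → (∀ x → T (f x) → T (g x)) →
            ∀ {x xs} → x ∈ xs → T (g x) → ¬ T (f x) → count f xs < count g xs
  count-< {f} {g} f⇒g {x} {xs} x∈xs gx ¬fx = ≤∧≢⇒< (count-mono f⇒g xs) λ counts≡ →
    ¬fx (proj₂ (∈-filter⁻ (T? ∘ f) {xs = xs} (subst (x ∈_)
      (sym (Pointwise-≡⇒≡ (to-≋ counts≡ (filterᵇ-⊆ f⇒g xs))))
      (∈-filter⁺ (T? ∘ g) x∈xs gx))))

  count-ext : {f g : A → Bool} → (∀ x → f x ≡ g x) → ∀ xs → count f xs ≡ count g xs
  count-ext f≗g xs = ≤-antisym (count-mono (λ x → subst T (f≗g x)) xs)
                               (count-mono (λ x → subst T (sym (f≗g x))) xs)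

  count-none : {f : A → Bool} → (∀ x → ¬ T (f x)) → ∀ xs → count f xs ≡ 0
  count-none {f} ¬f xs = cong length (filter-none (T? ∘ f) {xs = xs} (All.tabulate λ {x} _ → ¬f x))

  count-∨ : ∀ (f g : A → Bool) xs → count (λ x → f x ∨ g x) xs ≤ count f xs + count g xs
  count-∨ f g [] = z≤n
  count-∨ f g (x ∷ xs) with ih ← count-∨ f g xs | f x | g x
  ... | false | false = ih
  ... | false | true  = ≤-trans (s≤s ih) (≤-reflexive (sym (+-suc (count f xs) (count g xs))))
  ... | true  | false = s≤s ih
  ... | true  | true  = s≤s (≤-trans ih (+-monoʳ-≤ (count f xs) (n≤1+n (count g xs))))

  count-++ : ∀ (f : A → Bool) xs ys → count f (xs ++ ys) ≡ count f xs + count f ys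
  count-++ f xs ys = trans (cong length (filter-++ (T? ∘ f) xs ys)) (length-++ (filterᵇ f xs))

  count-filterᵇ : ∀ (b f : A → Bool) xs → count f (filterᵇ b xs) ≡ count (λ x → b x ∧ f x) xs
  count-filterᵇ b f [] = refl
  count-filterᵇ b f (x ∷ xs) with b x
  ... | false = count-filterᵇ b f xs
  ... | true with f x
  ...   | false = count-filterᵇ b f xs
  ...   | true  = cong suc (count-filterᵇ b f xs)

  anyL-intro : ∀ {p : A → Bool} {x xs} → x ∈ xs → T (p x) → T (anyL p xs)
  anyL-intro (here refl) px = Equivalence.from T-∨ (inj₁ px)
  anyL-intro (there x∈xs) px = Equivalence.from T-∨ (inj₂ (anyL-intro x∈xs px))

  anyL-elim : ∀ {p : A → Bool} xs → T (anyL p xs) → ∃[ x ] T (p x)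
  anyL-elim {p} (x ∷ xs) h with Equivalence.to (T-∨ {p x}) h
  ... | inj₁ px = x , px
  ... | inj₂ h′ = anyL-elim xs h′

  count-anyL : ∀ {I : Set} (h : I → A → Bool) (is : List I) xs →
    count (λ x → anyL (λ i → h i x) is) xs ≤ foldr _+_ 0 (map (λ i → count (h i) xs) is)
  count-anyL h [] xs = ≤-reflexive (count-none (λ _ ()) xs)
  count-anyL h (i ∷ is) xs = ≤-trans (count-∨ (h i) _ xs) (+-monoʳ-≤ (count (h i) xs) (count-anyL h is xs))

  ∃-maximal : (f : A → ℕ) (xs : List A) → (∀ x → x ∈ xs) → (S : A → Bool) → ∃[ x ] T (S x) →
              ∃[ v ] (T (S v) × (∀ w → T (S w) → f w ≤ f v))
  ∃-maximal f xs complete S (x , Sx) =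
    v , argmax-all f Sx (all-filter (T? ∘ S) xs) ,
    λ w Sw → All.lookup (f[xs]≤f[argmax] x (filterᵇ S xs)) (∈-filter⁺ (T? ∘ S) (complete w) Sw)
    where
    v : A
    v = argmax f x (filterᵇ S xs)

count-map : ∀ {A B : Set} (f : B → Bool) (g : A → B) xs → count f (map g xs) ≡ count (f ∘ g) xs
count-map f g [] = refl
count-map f g (x ∷ xs) with ih ← count-map f g xs | f (g x)
... | false = ih
... | true  = cong suc ih

maxL-≤ : ∀ {x xs} → x ∈ xs → x ≤ maxL xs
maxL-≤ {xs = y ∷ xs} (here refl) = m≤m⊔n y (maxL xs)
maxL-≤ {xs = y ∷ xs} (there x∈xs) = ≤-trans (maxL-≤ x∈xs) (m≤n⊔m y (maxL xs))

eqPos-refl : ∀ {t} (u : Pos t) → T (eqPos u u)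
eqPos-refl here = tt
eqPos-refl (left u) = eqPos-refl u
eqPos-refl (right u) = eqPos-refl u

eqPos-sound : ∀ {t} (u v : Pos t) → T (eqPos u v) → u ≡ v
eqPos-sound here here _ = refl
eqPos-sound (left u) (left v) e = cong left (eqPos-sound u v e)
eqPos-sound (right u) (right v) e = cong right (eqPos-sound u v e)

_≟ᴾ_ : ∀ {t} → DecidableEquality (Pos t)
u ≟ᴾ v = map′ (eqPos-sound u v) (λ { refl → eqPos-refl u }) (T? (eqPos u v))

eqPos-≢ : ∀ {t} {u v : Pos t} → u ≢ v → eqPos u v ≡ false
eqPos-≢ {u = u} {v} u≢v with eqPos u v in e
... | true  = contradiction (eqPos-sound u v (subst T (sym e) tt)) u≢v
... | false = refl

isAnc-refl : ∀ {t} (u : Pos t) → u ⪯ u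
isAnc-refl here = tt
isAnc-refl (left u) = isAnc-refl u
isAnc-refl (right u) = isAnc-refl u

allPos-complete : ∀ {t} (v : Pos t) → v ∈ allPos t
allPos-complete {leaf} here = here refl
allPos-complete {node l r} here = here refl
allPos-complete {node l r} (left u) = there (∈-++⁺ˡ (∈-map⁺ left (allPos-complete u)))
allPos-complete {node l r} (right u) = there (∈-++⁺ʳ (map left (allPos l)) (∈-map⁺ right (allPos-complete u)))

parent-nothing : ∀ {t} {v : Pos t} → parent v ≡ nothing → v ≡ here
parent-nothing {v = here} _ = refl

parent-nonroot : ∀ {t} {v : Pos t} → v ≢ here → ∃[ q ] parent v ≡ just q
parent-nonroot {v = here} v≢root = contradiction refl v≢root
parent-nonroot {v = left _} _ = _ , refl
parent-nonroot {v = right _} _ = _ , refl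

parent⇒≺ : ∀ {t} {v q : Pos t} → parent v ≡ just q → q ≺ v
parent⇒≺ {v = left u} e with parent u in eu
parent⇒≺ {v = left u} refl | nothing = tt , λ ()
parent⇒≺ {v = left u} refl | just _ with parent⇒≺ eu
... | q⪯u , q≢u = q⪯u , λ { refl → q≢u refl }
parent⇒≺ {v = right u} e with parent u in eu
parent⇒≺ {v = right u} refl | nothing = tt , λ ()
parent⇒≺ {v = right u} refl | just _ with parent⇒≺ eu
... | q⪯u , q≢u = q⪯u , λ { refl → q≢u refl }

parent-internal : ∀ {t} {v q : Pos t} → parent v ≡ just q → T (not (isLeaf q))
parent-internal {v = left u} e with parent u in eu
parent-internal {v = left u} refl | nothing = tt
parent-internal {v = left u} refl | just _ = parent-internal eu
parent-internal {v = right u} e with parent u in eu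
parent-internal {v = right u} refl | nothing = tt
parent-internal {v = right u} refl | just _ = parent-internal eu

isParentOf⇒parent≡ : ∀ {t} {u w : Pos t} → T (isParentOf u w) → parent w ≡ just u
isParentOf⇒parent≡ {u = u} {w} h with parent w
... | just q = cong just (eqPos-sound q u h)

parent≡⇒isParentOf : ∀ {t} {u w : Pos t} → parent w ≡ just u → T (isParentOf u w)
parent≡⇒isParentOf {u = u} e rewrite e = eqPos-refl u

count-allPos-node : ∀ l r (f : Pos (node l r) → Bool) →
  count f (allPos (node l r)) ≡ count f (here ∷ []) + (count (f ∘ left) (allPos l) + count (f ∘ right) (allPos r))
count-allPos-node l r f = begin
  count f (allPos (node l r))
    ≡⟨ count-++ f (here ∷ []) (map left (allPos l) ++ map right (allPos r)) ⟩
  count f (here ∷ []) + count f (map left (allPos l) ++ map right (allPos r))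
    ≡⟨ cong (count f (here ∷ []) +_) (count-++ f (map left (allPos l)) (map right (allPos r))) ⟩
  count f (here ∷ []) + (count f (map left (allPos l)) + count f (map right (allPos r)))
    ≡⟨ cong (count f (here ∷ []) +_) (cong₂ _+_ (count-map f left (allPos l)) (count-map f right (allPos r))) ⟩
  count f (here ∷ []) + (count (f ∘ left) (allPos l) + count (f ∘ right) (allPos r)) ∎
  where open ≡-Reasoning

count-eqPos : ∀ {t} (q : Pos t) → count (eqPos q) (allPos t) ≡ 1
count-eqPos {leaf} here = refl
count-eqPos {node l r} here = trans (count-allPos-node l r (eqPos here))
  (cong suc (cong₂ _+_ (count-none (λ _ ()) (allPos l)) (count-none (λ _ ()) (allPos r))))
count-eqPos {node l r} (left q) = trans (count-allPos-node l r (eqPos (left q)))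
  (trans (cong (count (eqPos q) (allPos l) +_) (count-none (λ _ ()) (allPos r)))
         (trans (+-identityʳ _) (count-eqPos q)))
count-eqPos {node l r} (right q) = trans (count-allPos-node l r (eqPos (right q)))
  (trans (cong (_+ count (eqPos q) (allPos r)) (count-none (λ _ ()) (allPos l))) (count-eqPos q))

count-parents : ∀ {t} (v : Pos t) → count (λ w → isParentOf w v) (allPos t) ≤ 1
count-parents {t} v with parent v
... | nothing = ≤-trans (≤-reflexive (count-none (λ _ ()) (allPos t))) z≤n
... | just q  = ≤-reflexive (count-eqPos q)

count-children : ∀ {t} (p : Pos t) → count (isParentOf p) (allPos t) ≤ 2
count-children {leaf} here = z≤n
count-children {node l r} here = ≤-reflexive (trans (count-allPos-node l r (isParentOf here))
  (cong₂ _+_ (trans (count-ext here-left (allPos l)) (count-eqPos {l} here))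
             (trans (count-ext here-right (allPos r)) (count-eqPos {r} here))))
  where
  here-left : ∀ w → isParentOf {node l r} here (left w) ≡ eqPos here w
  here-left here = refl
  here-left (left _) = refl
  here-left (right _) = refl
  here-right : ∀ w → isParentOf {node l r} here (right w) ≡ eqPos here w
  here-right here = refl
  here-right (left _) = refl
  here-right (right _) = refl
count-children {node l r} (left p) = ≤-trans (≤-reflexive (trans (count-allPos-node l r (isParentOf (left p)))
  (trans (cong₂ _+_ (count-ext left-left (allPos l)) (count-none left-right (allPos r))) (+-identityʳ _))))
  (count-children p)
  where
  left-left : ∀ w → isParentOf {node l r} (left p) (left w) ≡ isParentOf p w
  left-left w with parent w
  ... | nothing = refl
  ... | just _  = refl
  left-right : ∀ w → ¬ T (isParentOf {node l r} (left p) (right w))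
  left-right w with parent w
  ... | nothing = λ ()
  ... | just _  = λ ()
count-children {node l r} (right p) = ≤-trans (≤-reflexive (trans (count-allPos-node l r (isParentOf (right p)))
  (cong₂ _+_ (count-none right-left (allPos l)) (count-ext right-right (allPos r)))))
  (count-children p)
  where
  right-left : ∀ w → ¬ T (isParentOf {node l r} (right p) (left w))
  right-left w with parent w
  ... | nothing = λ ()
  ... | just _  = λ ()
  right-right : ∀ w → isParentOf {node l r} (right p) (right w) ≡ isParentOf p w
  right-right w with parent w
  ... | nothing = refl
  ... | just _  = refl

∈-2+-upTo : ∀ {t n} → 2 ≤ t → t ≤ n → t ∈ map (2 +_) (upTo (n ∸ 1))
∈-2+-upTo (s≤s (s≤s _)) t≤n = ∈-map⁺ (2 +_) (∈-upTo⁺ (∸-monoˡ-≤ 1 t≤n))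

module _ {k : ℕ} {Y : BTree} (Z : Fin k → Pos Y → Pos Y → Bool) where

  zEdge-elim : ∀ {v w} → T (zEdge Y Z v w) → ∃[ i ] T (Z i v w ∨ Z i w v)
  zEdge-elim {v} {w} h with Equivalence.to (T-∨ {inZ Y Z v w}) h
  ... | inj₁ vw with anyL-elim (allFin k) vw
  ...   | i , z = i , Equivalence.from T-∨ (inj₁ z)
  zEdge-elim h | inj₂ wv with anyL-elim (allFin k) wv
  ...   | i , z = i , Equivalence.from T-∨ (inj₂ z)

  rStar-intro : ∀ {i u v u′ v′} → u ⪯ u′ → v ⪯ v′ → u ≢ u′ → T (Z i u′ v′ ∨ Z i v′ u′) → T (rStar Y Z i u v)
  rStar-intro {u = u} {v} {u′} {v′} u⪯u′ v⪯v′ u≢u′ z =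
    anyL-intro (allPos-complete u′) (anyL-intro (allPos-complete v′)
      (Equivalence.from T-∧ (u⪯u′ , Equivalence.from T-∧ (v⪯v′ , Equivalence.from T-∧ (distinct , z)))))
    where
    distinct : T (not (eqPos u u′ ∧ eqPos v v′))
    distinct rewrite eqPos-≢ u≢u′ = tt

module Ranked {k : ℕ} {Y : BTree} (Z : Fin k → Pos Y → Pos Y → Bool) (τ : Pos Y → ℕ)
              (ranking : IsRanking Y Z τ) where

  τπ : Pos Y → ℕ
  τπ = parentRank Y Z τ

  internal-rank : ∀ {u} → T (not (isLeaf u)) → 1 ≤ τ u × τ u ≤ nLeaves Y ∸ 1
  internal-rank = proj₁ ranking _

  rank-injective : ∀ {u v} → T (not (isLeaf u)) → T (not (isLeaf v)) → τ u ≡ τ v → u ≡ v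
  rank-injective = proj₁ (proj₂ ranking) _ _

  rank-monotone : ∀ {u v} → u ≺ v → τ u < τ v
  rank-monotone = proj₁ (proj₂ (proj₂ (proj₂ (proj₂ ranking)))) _ _

  Z-ranks : ∀ {i u v} → T (Z i u v) → τπ u ⊔ τπ v < τ u ⊓ τ v
  Z-ranks = proj₂ (proj₂ (proj₂ (proj₂ (proj₂ ranking)))) _ _ _

  τπ-just : ∀ {v q} → parent v ≡ just q → τπ v ≡ τ q
  τπ-just e rewrite e = refl

  rank-root-≤ : ∀ u → τ here ≤ τ u
  rank-root-≤ u with here ≟ᴾ u
  ... | yes refl = ≤-refl
  ... | no root≢u = <⇒≤ (rank-monotone (tt , root≢u))

  τπ<rank-of-parent : ∀ {v w} → parent w ≡ just v → τπ v < τ v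
  τπ<rank-of-parent {v} ew with parent v in ev
  ... | just p  = rank-monotone (parent⇒≺ ev)
  ... | nothing = proj₁ (internal-rank (parent-internal ew))

  Z-τπ<rank : ∀ {i v w} → T (Z i v w ∨ Z i w v) → τπ v < τ w
  Z-τπ<rank {i} {v} {w} z with Equivalence.to (T-∨ {Z i v w}) z
  ... | inj₁ vw = <-≤-trans (m⊔n<o⇒m<o (τπ v) (τπ w) (Z-ranks vw)) (m⊓n≤n (τ v) (τ w))
  ... | inj₂ wv = <-≤-trans (m⊔n<o⇒n<o (τπ w) (τπ v) (Z-ranks wv)) (m⊓n≤m (τ w) (τ v))

  onBoundary : ℕ → Pos Y → Bool
  onBoundary t u = (t ≤ᵇ τ u) ∧ maybe′ (λ p → τ p <ᵇ t) false (parent u)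

  onBoundary-intro : ∀ {t u q} → t ≤ τ u → parent u ≡ just q → τ q < t → T (onBoundary t u)
  onBoundary-intro t≤τu e τq<t rewrite e = Equivalence.from T-∧ (≤⇒≤ᵇ t≤τu , <⇒<ᵇ τq<t)

  ¬onBoundary-root : ∀ w → ¬ T (onBoundary (τ here) w)
  ¬onBoundary-root w h with parent w | proj₂ (Equivalence.to (T-∧ {τ here ≤ᵇ τ w}) h)
  ... | just q | τq<τroot = <⇒≱ (<ᵇ⇒< (τ q) (τ here) τq<τroot) (rank-root-≤ q)

  starDeg≤width : ∀ {t u} → 2 ≤ t → t ≤ nLeaves Y → T (onBoundary t u) → starDeg Y Z τ t u ≤ width Y Z τ
  starDeg≤width {t} {u} 2≤t t≤n h = maxL-≤ (∈-concatMap⁺ (λ s → map (starDeg Y Z τ s) (boundary Y Z τ s))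
    (Any.map (λ { refl → ∈-map⁺ (starDeg Y Z τ t) u∈∂ }) (∈-2+-upTo 2≤t t≤n)))
    where
    u∈∂ : u ∈ boundary Y Z τ t
    u∈∂ = ∈-filter⁺ (T? ∘ onBoundary t) (allPos-complete u) h

  starNeighbour : Pos Y → Pos Y → Bool
  starNeighbour p w = onBoundary (τ p) w ∧ anyFin k (λ i → rStar Y Z i p w)

  count-starNeighbour : ∀ {p} → T (not (isLeaf p)) → count (starNeighbour p) (allPos Y) ≤ width Y Z τ
  count-starNeighbour {p} p-internal with parent p in e
  ... | nothing rewrite parent-nothing e = ≤-trans
          (≤-reflexive (count-none (λ w → ¬onBoundary-root w ∘ proj₁ ∘ Equivalence.to T-∧) (allPos Y))) z≤n
  ... | just r = begin
    count (starNeighbour p) (allPos Y)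
      ≡⟨ count-filterᵇ (onBoundary (τ p)) (λ w → anyFin k (λ i → rStar Y Z i p w)) (allPos Y) ⟨
    count (λ w → anyFin k (λ i → rStar Y Z i p w)) (boundary Y Z τ (τ p))
      ≤⟨ count-anyL (λ i → rStar Y Z i p) (allFin k) (boundary Y Z τ (τ p)) ⟩
    starDeg Y Z τ (τ p) p
      ≤⟨ starDeg≤width 2≤τp (≤-trans τp≤n∸1 (m∸n≤m _ 1)) (onBoundary-intro ≤-refl e τr<τp) ⟩
    width Y Z τ ∎
    where
    open ≤-Reasoning
    τr<τp : τ r < τ p
    τr<τp = rank-monotone (parent⇒≺ e)
    2≤τp : 2 ≤ τ p
    2≤τp = ≤-<-trans (proj₁ (internal-rank (parent-internal e))) τr<τp
    τp≤n∸1 : τ p ≤ nLeaves Y ∸ 1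
    τp≤n∸1 = proj₂ (internal-rank p-internal)

  module Maximal (S : Pos Y → Bool) {v : Pos Y} (maximal : ∀ w → T (S w) → τπ w ≤ τπ v) where

    no-child-in-S : ∀ {w} → T (S w) → ¬ T (isParentOf v w)
    no-child-in-S {w} Sw child = <⇒≱ (τπ<rank-of-parent ew) (≤-trans (≤-reflexive (sym (τπ-just ew))) (maximal w Sw))
      where
      ew : parent w ≡ just v
      ew = isParentOf⇒parent≡ {u = v} {w} child

    neighbour-cases : ∀ {w} → T (S w ∧ gaifmanAdj Y Z v w) → w ≢ v × (T (isParentOf w v) ⊎ T (zEdge Y Z v w))
    neighbour-cases {w} h with Equivalence.to (T-∧ {S w}) h
    ... | Sw , adj with Equivalence.to (T-∧ {not (eqPos v w)}) adj
    ...   | v≠w , edge = (λ { refl → subst T (Equivalence.to T-not-≡ v≠w) (eqPos-refl v) }) , edge-cases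
      where
      edge-cases : T (isParentOf w v) ⊎ T (zEdge Y Z v w)
      edge-cases with Equivalence.to (T-∨ {yEdge Y Z v w}) edge
      ... | inj₂ z = inj₂ z
      ... | inj₁ y with Equivalence.to (T-∨ {isParentOf v w}) y
      ...   | inj₁ child = contradiction child (no-child-in-S Sw)
      ...   | inj₂ par = inj₁ par

    Z-neighbour-cases : ∀ {p w} → parent v ≡ just p → T (S w) → T (zEdge Y Z v w) →
                        T (isParentOf p w) ⊎ T (starNeighbour p w)
    Z-neighbour-cases {p} {w} ev Sw z with zEdge-elim Z z
    ... | i , zi with parent-nonroot {v = w} (λ { refl → <⇒≱ τp<τw (rank-root-≤ p) })
      where
      τp<τw : τ p < τ w
      τp<τw = subst (_< τ w) (τπ-just ev) (Z-τπ<rank {v = v} {w} zi)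
    ...   | q , ew with q ≟ᴾ p
    ...     | yes refl = inj₁ (parent≡⇒isParentOf ew)
    ...     | no q≢p = inj₂ (Equivalence.from T-∧ (onBoundary-intro (<⇒≤ τp<τw) ew τq<τp ,
                        anyL-intro (∈-allFin i) (rStar-intro Z {v = w} (proj₁ (parent⇒≺ ev)) (isAnc-refl w) (proj₂ (parent⇒≺ ev)) zi)))
      where
      τp<τw : τ p < τ w
      τp<τw = subst (_< τ w) (τπ-just ev) (Z-τπ<rank {v = v} {w} zi)
      τq≤τp : τ q ≤ τ p
      τq≤τp = subst₂ _≤_ (τπ-just ew) (τπ-just ev) (maximal w Sw)
      τq<τp : τ q < τ p
      τq<τp = ≤∧≢⇒< τq≤τp (q≢p ∘ rank-injective (parent-internal ew) (parent-internal ev))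

    only-root-in-S : v ≡ here → ∀ {w} → T (S w) → w ≡ here
    only-root-in-S v≡root {w} Sw with w ≟ᴾ here
    ... | yes w≡root = w≡root
    ... | no w≢root with parent-nonroot w≢root
    ...   | q , ew = contradiction (maximal w Sw)
                       (<⇒≱ (subst₂ _<_ (sym (cong τπ v≡root)) (sym (τπ-just ew)) (proj₁ (internal-rank (parent-internal ew)))))

    degree-at-root : v ≡ here → count (λ w → S w ∧ gaifmanAdj Y Z v w) (allPos Y) ≡ 0
    degree-at-root v≡root = count-none
      (λ w h → proj₁ (neighbour-cases h) (trans (only-root-in-S v≡root (proj₁ (Equivalence.to T-∧ h))) (sym v≡root)))
      (allPos Y)

    degree-without-Z : (∀ w → ¬ T (zEdge Y Z v w)) → count (λ w → S w ∧ gaifmanAdj Y Z v w) (allPos Y) ≤ 1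
    degree-without-Z noZ = ≤-trans (count-mono parent-only (allPos Y)) (count-parents v)
      where
      parent-only : ∀ w → T (S w ∧ gaifmanAdj Y Z v w) → T (isParentOf w v)
      parent-only w h with proj₂ (neighbour-cases h)
      ... | inj₁ par = par
      ... | inj₂ z   = contradiction z (noZ w)

    -- v itself is one of the (at most two) children of p, but not its own neighbour.
    degree-below : ∀ {p} → parent v ≡ just p → count (λ w → S w ∧ gaifmanAdj Y Z v w) (allPos Y) ≤ 2 + width Y Z τ
    degree-below {p} ev = ≤-pred (begin-strict
      count (λ w → S w ∧ gaifmanAdj Y Z v w) (allPos Y)
        <⟨ count-< covered (allPos-complete v) v-covered
                   (λ h → proj₁ (neighbour-cases h) refl) ⟩
      count cover (allPos Y)
        ≤⟨ count-∨ (λ w → isParentOf w v) (λ w → isParentOf p w ∨ starNeighbour p w) (allPos Y) ⟩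
      count (λ w → isParentOf w v) (allPos Y) + count (λ w → isParentOf p w ∨ starNeighbour p w) (allPos Y)
        ≤⟨ +-mono-≤ (count-parents v) (count-∨ (isParentOf p) (starNeighbour p) (allPos Y)) ⟩
      1 + (count (isParentOf p) (allPos Y) + count (starNeighbour p) (allPos Y))
        ≤⟨ +-monoʳ-≤ 1 (+-mono-≤ (count-children p) (count-starNeighbour (parent-internal ev))) ⟩
      1 + (2 + width Y Z τ) ∎)
      where
      open ≤-Reasoning
      cover : Pos Y → Bool
      cover w = isParentOf w v ∨ (isParentOf p w ∨ starNeighbour p w)
      v-covered : T (cover v)
      v-covered = Equivalence.from (T-∨ {isParentOf v v}) (inj₂ (Equivalence.from (T-∨ {isParentOf p v}) (inj₁ (parent≡⇒isParentOf ev))))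
      covered : ∀ w → T (S w ∧ gaifmanAdj Y Z v w) → T (cover w)
      covered w h with proj₂ (neighbour-cases h)
      ... | inj₁ par = Equivalence.from (T-∨ {isParentOf w v}) (inj₁ par)
      ... | inj₂ z   = Equivalence.from (T-∨ {isParentOf w v}) (inj₂ (Equivalence.from (T-∨ {isParentOf p w})
                         (Z-neighbour-cases {w = w} ev (proj₁ (Equivalence.to (T-∧ {S w}) h)) z)))

    degree≤2+width : count (λ w → S w ∧ gaifmanAdj Y Z v w) (allPos Y) ≤ 2 + width Y Z τ
    degree≤2+width with v ≟ᴾ here
    ... | yes v≡root = ≤-trans (≤-reflexive (degree-at-root v≡root)) z≤n
    ... | no v≢root with parent-nonroot v≢root
    ...   | p , ev = degree-below ev

maximal-degree : ∀ {k Y} (Z : Fin k → Pos Y → Pos Y → Bool) (τ : Pos Y → ℕ) → IsRanking Y Z τ → (S : Pos Y → Bool) → ∀ {v} →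
  (∀ w → T (S w) → parentRank Y Z τ w ≤ parentRank Y Z τ v) →
  count (λ w → S w ∧ gaifmanAdj Y Z v w) (allPos Y) ≤ width Y Z τ + k + 1
maximal-degree {zero} Z τ ranking S {v} maximal = ≤-trans (degree-without-Z (λ _ ())) (m≤n+m 1 _)
  where open Ranked Z τ ranking; open Maximal S {v} maximal
maximal-degree {suc k} {Y} Z τ ranking S {v} maximal = ≤-trans degree≤2+width (begin
  2 + width Y Z τ         ≡⟨ +-comm 2 (width Y Z τ) ⟩
  width Y Z τ + 2         ≤⟨ +-monoʳ-≤ (width Y Z τ) (s≤s (m≤n+m 1 k)) ⟩
  width Y Z τ + (suc k + 1) ≡⟨ +-assoc (width Y Z τ) (suc k) 1 ⟨
  width Y Z τ + suc k + 1 ∎)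
  where open Ranked Z τ ranking; open Maximal S {v} maximal; open ≤-Reasoning

mainTheorem5 : (k : ℕ) (Y : BTree) (Z : Fin k → Pos Y → Pos Y → Bool)
    (𝐀 : Structure k Y) → IsTwinModelOf Y Z 𝐀 →
    (τ : Pos Y → ℕ) → IsRanking Y Z τ →
    (d : ℕ) → width Y Z τ ≡ d →
    Degenerate (d + k + 1) (allPos Y) (gaifmanAdj Y Z)
mainTheorem5 k Y Z _ _ τ ranking _ refl S nonempty
  with ∃-maximal (parentRank Y Z τ) (allPos Y) allPos-complete S nonempty
... | v , Sv , maximal = v , Sv , maximal-degree Z τ ranking S maximal
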